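{- D-SAP (defined in the context) with a weakly Pareto-conform psychological model and cost functions with Pareto dimension $k$ reduces to solving a multi-criteria shortest path problem with $k$ criteria and scoring the result. That is, in the graph obtained from $G$ by removing the edges of $Q$, with edge weights $w(e)=p(\tau_e)\in\mathbb{Q}^k$, the set of $s$–$t$ paths whose total weight is not Pareto dominated by that of another $s$–$t$ path contains an optimal solution of D-SAP.
   Context: Setting. Let $G=(V,E)$ be a directed graph, $s,t\in V$, $d>0$ rational. Every edge $e$ has a cost function $\tau_e:\mathbb{Q}_{\ge 0}\to\mathbb{Q}_{>0}$, monotonically increasing and differentiable; functions are considered on $[0,d]$ and inequalities between functions are pointwise on $[0,d]$. Paths are identified with edge sets; $\tau_A=\sum_{e\in A}\tau_e$ (zero if $A=\emptyset$), $\tau'_A$ its derivative. An original simple $s$–$t$ path $Q$ is fixed. An alternative is a simple $s$–$t$ path $P$; $\mathcal{C}_P(x)=x\,\tau_{P\setminus Q}(x)+(d-x)\,\tau_{Q\setminus P}(d-x)+d\,\tau_{P\cap Q}(d)$. A psychological model assigns to each alternative $P$ a value $x_P\in[0,d]$, and $\mathcal{C}_P:=\mathcal{C}_P(x_P)$. D-SAP asks for an alternative $P$ edge-disjoint from $Q$ minimizing $\mathcal{C}_P$. Dominance: $P_1\preceq P_2$ iff $\tau_{P_1}\le\tau_{P_2}$ and $\tau'_{P_1\cap Q}\le\tau'_{P_2\cap Q}$. The model is weakly Pareto-conform if $P_1\preceq P_2$ implies $\mathcal{C}_{P_1}\le\mathcal{C}_{P_2}$ whenever $P_1\cap Q=P_2\cap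 Q$. Standing assumption: no two different paths dominate each other mutually. A class $\mathcal{T}$ of functions on $[0,d]$ closed under addition has Pareto dimension $k$ if there is $p:\mathcal{T}\to\mathbb{Q}^k$ with $\tau_1\le\tau_2$ iff $p(\tau_1)\le p(\tau_2)$ componentwise and $p(\tau_1+\tau_2)=p(\tau_1)+p(\tau_2)$; "cost functions with Pareto dimension $k$" means all $\tau_e$ lie in such a class with representation $p$. A multi-criteria shortest path problem with $m$ criteria: given edge weights in $\mathbb{Q}^m$ (path weight = sum), compute all $s$–$t$ paths whose weight is not Pareto dominated (componentwise $\le$ and different) by that of another $s$–$t$ path. Scoring means computing $\mathcal{C}_P$ for each resulting path and choosing the best. -}

module Defs where

open import Data.Nat using (ℕ)
open import Data.Fin using (Fin) renaming (_≟_ to _≟ᶠ_)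
open import Data.Rational using (ℚ; 0ℚ; _+_; _*_; _-_; _≤_; _<_; ∣_∣)
open import Data.List using (List; []; _∷_; map; filter; foldr)
open import Data.List.Membership.Propositional using (_∈_; _∉_)
open import Data.List.Relation.Unary.Unique.Propositional using (Unique)
open import Data.Vec using (Vec; zipWith; replicate)
open import Data.Vec.Relation.Binary.Pointwise.Inductive using (Pointwise)
open import Data.Product using (_×_; ∃; Σ-syntax)
open import Relation.Binary.PropositionalEquality using (_≡_; _≢_)
open import Relation.Nullary using (¬_; ¬?)
open import Function.Bundles using (_⇔_)

Fun : Set
Fun = ℚ → ℚ

InInterval : ℚ → ℚ → Set
InInterval d x = (0ℚ ≤ x) × (x ≤ d)

_≤[_]_ : Fun → ℚ → Fun → Set
f ≤[ d ] g = ∀ x → InInterval d x → f x ≤ g x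

_+ᶠ_ : Fun → Fun → Fun
(f +ᶠ g) x = f x + g x

0ᶠ : Fun
0ᶠ _ = 0ℚ

-- f' is the derivative of f on [0,d] (one-sided at the endpoints),
-- epsilon-delta definition over the rationals
IsDerivativeOn : ℚ → Fun → Fun → Set
IsDerivativeOn d f f' =
  ∀ x → InInterval d x → ∀ ε → 0ℚ < ε → ∃ λ δ → (0ℚ < δ) ×
    (∀ y → InInterval d y → ∣ y - x ∣ < δ →
       ∣ f y - f x - f' x * (y - x) ∣ ≤ ε * ∣ y - x ∣)

record Graph : Set where
  field
    n m  : ℕ
    tail : Fin m → Fin n
    head : Fin m → Fin n

module _ (G : Graph) where
  open Graph G

  IsWalk : Fin n → Fin n → List (Fin m) → Set
  IsWalk u v []       = u ≡ v
  IsWalk u v (e ∷ es) = (tail e ≡ u) × IsWalk (head e) v es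

  walkVertices : Fin n → List (Fin m) → List (Fin n)
  walkVertices u es = u ∷ map head es

  IsSimplePath : Fin n → Fin n → List (Fin m) → Set
  IsSimplePath u v es = IsWalk u v es × Unique (walkVertices u es)

-- Edge-set operations (paths identified with their edge sets)

module _ {m : ℕ} where
  open import Data.List.Membership.DecPropositional (_≟ᶠ_ {m}) using (_∈?_)

  _∖_ : List (Fin m) → List (Fin m) → List (Fin m)
  A ∖ B = filter (λ e → ¬? (e ∈? B)) A

  _∩_ : List (Fin m) → List (Fin m) → List (Fin m)
  A ∩ B = filter (λ e → e ∈? B) A

  EdgeDisjoint : List (Fin m) → List (Fin m) → Set
  EdgeDisjoint A B = ∀ e → e ∈ A → e ∉ B

  SameEdgeSet : List (Fin m) → List (Fin m) → Set
  SameEdgeSet A B = ∀ e → (e ∈ A) ⇔ (e ∈ B)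

  sumFun : (Fin m → Fun) → List (Fin m) → Fun
  sumFun τ A = foldr (λ e acc → τ e +ᶠ acc) 0ᶠ A

_≤ᵛ_ : {k : ℕ} → Vec ℚ k → Vec ℚ k → Set
_≤ᵛ_ = Pointwise _≤_

_+ᵛ_ : {k : ℕ} → Vec ℚ k → Vec ℚ k → Vec ℚ k
_+ᵛ_ = zipWith _+_

_<ᴾ_ : {k : ℕ} → Vec ℚ k → Vec ℚ k → Set
a <ᴾ b = (a ≤ᵛ b) × (a ≢ b)

pathWeight : {m k : ℕ} → (Fin m → Vec ℚ k) → List (Fin m) → Vec ℚ k
pathWeight {k = k} w A = foldr (λ e acc → w e +ᵛ acc) (replicate k 0ℚ) A

record ParetoDimension (d : ℚ) (k : ℕ) (𝒯 : Fun → Set) (p : Fun → Vec ℚ k) : Set where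
  field
    closed+   : ∀ f g → 𝒯 f → 𝒯 g → 𝒯 (f +ᶠ g)
    order-iff : ∀ f g → 𝒯 f → 𝒯 g → (f ≤[ d ] g) ⇔ (p f ≤ᵛ p g)
    additive  : ∀ f g → 𝒯 f → 𝒯 g → p (f +ᶠ g) ≡ p f +ᵛ p g

record CostFunctions (G : Graph) (d : ℚ) : Set where
  open Graph G
  field
    τ    : Fin m → Fun
    τ'   : Fin m → Fun
    positive     : ∀ e x → 0ℚ ≤ x → 0ℚ < τ e x
    monotone     : ∀ e x y → 0ℚ ≤ x → x ≤ y → τ e x ≤ τ e y
    differentiable : ∀ e → IsDerivativeOn d (τ e) (τ' e)

module Setting (G : Graph) (d : ℚ) (c : CostFunctions G d)
               (s t : Fin (Graph.n G)) (Q : List (Fin (Graph.m G))) where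
  open Graph G
  open CostFunctions c

  τ[_] : List (Fin m) → Fun
  τ[ A ] = sumFun τ A

  τ'[_] : List (Fin m) → Fun
  τ'[ A ] = sumFun τ' A

  Alternative : List (Fin m) → Set
  Alternative P = IsSimplePath G s t P

  𝒞 : List (Fin m) → ℚ → ℚ
  𝒞 P x = x * τ[ P ∖ Q ] x + (d - x) * τ[ Q ∖ P ] (d - x) + d * τ[ P ∩ Q ] d

  _⪯_ : List (Fin m) → List (Fin m) → Set
  P₁ ⪯ P₂ = (τ[ P₁ ] ≤[ d ] τ[ P₂ ]) × (τ'[ P₁ ∩ Q ] ≤[ d ] τ'[ P₂ ∩ Q ])

  NoMutualDominance : Set
  NoMutualDominance = ∀ P₁ P₂ → Alternative P₁ → Alternative P₂ →
    P₁ ≢ P₂ → ¬ ((P₁ ⪯ P₂) × (P₂ ⪯ P₁))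

  record PsychModel : Set where
    field
      xval    : List (Fin m) → ℚ
      inRange : ∀ P → Alternative P → InInterval d (xval P)

    𝒞[_] : List (Fin m) → ℚ
    𝒞[ P ] = 𝒞 P (xval P)

  WeaklyParetoConform : PsychModel → Set
  WeaklyParetoConform M = ∀ P₁ P₂ → Alternative P₁ → Alternative P₂ →
    SameEdgeSet (P₁ ∩ Q) (P₂ ∩ Q) → P₁ ⪯ P₂ → 𝒞[ P₁ ] ≤ 𝒞[ P₂ ]
    where open PsychModel M

  DFeasible : List (Fin m) → Set
  DFeasible P = Alternative P × EdgeDisjoint P Q

  OptimalDSAP : PsychModel → List (Fin m) → Set
  OptimalDSAP M P = DFeasible P × (∀ P' → DFeasible P' → 𝒞[ P ] ≤ 𝒞[ P' ])
    where open PsychModel M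

  PathInGminusQ : List (Fin m) → Set
  PathInGminusQ P = IsSimplePath G s t P × (∀ e → e ∈ P → e ∉ Q)

  ParetoOptimal : {k : ℕ} → (Fin m → Vec ℚ k) → List (Fin m) → Set
  ParetoOptimal w P = PathInGminusQ P ×
    (∀ P' → PathInGminusQ P' → ¬ (pathWeight w P' <ᴾ pathWeight w P))

-- A Q-disjoint path P has P ∩ Q = ∅, so for two such paths the derivative condition of ⪯ and
-- the premise P₁ ∩ Q = P₂ ∩ Q of weak Pareto conformity hold trivially, while the Pareto
-- representation p turns componentwise ≤ of weights into τ_{P'} ≤ τ_P. Hence Pareto dominance
-- of weights never increases the D-SAP cost. Feasible paths are finitely many, so among the
-- optimal ones we can pick one of least coordinate sum of its weight; a path with strictly
-- dominating weight would be optimal as well and have strictly smaller coordinate sum, so the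
-- chosen path is Pareto optimal. Breaking ties by the coordinate sum makes the standing
-- assumption of no mutual dominance unnecessary.
module Submission where

open import Defs
open import Data.Nat using (ℕ; zero; suc; s≤s)
import Data.Nat as ℕ
import Data.Nat.Properties as ℕ
open import Data.Fin using (Fin) renaming (_≟_ to _≟ᶠ_)
import Data.Fin as Fin
import Data.Fin.Properties as Fin
open import Data.Rational using (ℚ; 0ℚ; _<_; _≤_; _+_)
import Data.Rational.Properties as ℚ
open import Data.List using (List; []; _∷_; [_]; map; filter; length; lookup; allFin; cartesianProductWith)
import Data.List.Properties as List
open import Data.List.Membership.Propositional using (_∈_)
open import Data.List.Membership.Propositional.Properties
  using (∈-filter⁺; ∈-filter⁻; ∈-allFin; ∈-lookup; ∈-cartesianProductWith⁺)
open import Data.List.Relation.Binary.Subset.Propositional using (_⊆_)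
open import Data.List.Relation.Unary.Any using (here; there)
import Data.List.Relation.Unary.All as All
open import Data.List.Relation.Unary.AllPairs using (_∷_)
open import Data.List.Relation.Unary.Unique.Propositional using (Unique)
open import Data.Vec using (Vec; []; _∷_)
import Data.Vec.Properties as Vec
open import Data.Vec.Relation.Binary.Pointwise.Inductive using ([]; _∷_)
open import Data.Product using (_×_; _,_; proj₂; ∃)
open import Data.Empty using (⊥-elim)
open import Relation.Nullary using (¬_; ¬?; Dec; yes; no)
open import Relation.Nullary.Decidable using (_×-dec_; map′)
open import Relation.Unary using (Decidable)
open import Relation.Binary using (DecTotalOrder)
open import Relation.Binary.PropositionalEquality using (_≡_; _≢_; refl; sym; trans; cong; subst; subst₂)
open import Function.Bundles using (_⇔_; mk⇔; Equivalence)
open import Function.Construct.Identity using (⇔-id)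
open import Data.List.Extrema (DecTotalOrder.totalOrder ℚ.≤-decTotalOrder)
  using (argmin; argmin-all; f[argmin]≤f[xs])

module _ {A : Set} where

  Enumerable : (A → Set) → Set
  Enumerable P = ∃ λ (xs : List A) → ∀ x → x ∈ xs ⇔ P x

  enumerable-cover : {P : A → Set} (xs : List A) → (∀ x → P x → x ∈ xs) → Decidable P →
                     Enumerable P
  enumerable-cover xs cover P? =
    filter P? xs , λ x → mk⇔ (λ x∈ → proj₂ (∈-filter⁻ P? {xs = xs} x∈))
                             (λ px → ∈-filter⁺ P? (cover x px) px)

  enumerable-restrict : {P R : A → Set} → Enumerable P → Decidable R →
                        Enumerable (λ x → P x × R x)
  enumerable-restrict (xs , enum) R? = filter R? xs , λ x → mk⇔
    (λ x∈ → let x∈xs , rx = ∈-filter⁻ R? {xs = xs} x∈ in Equivalence.to (enum x) x∈xs , rx)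
    (λ (px , rx) → ∈-filter⁺ R? (Equivalence.from (enum x) px) rx)

  Minimises : (A → Set) → (A → ℚ) → A → Set
  Minimises P f y = P y × (∀ z → P z → f y ≤ f z)

  minimiser : {P : A → Set} → Enumerable P → ∀ {x₀} → P x₀ → (f : A → ℚ) → ∃ (Minimises P f)
  minimiser (xs , enum) {x₀} px₀ f =
    argmin f x₀ xs ,
    argmin-all f px₀ (All.tabulate λ {x} x∈ → Equivalence.to (enum x) x∈) ,
    λ z pz → All.lookup (f[argmin]≤f[xs] x₀ xs) (Equivalence.from (enum z) pz)

  lexMinimiser : {P : A → Set} → Enumerable P → ∀ {x₀} → P x₀ → (f g : A → ℚ) →
                 ∃ λ y → Minimises P f y × Minimises (λ z → P z × f z ≤ f y) g y
  lexMinimiser enum px₀ f g with minimiser enum px₀ f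
  ... | y₁ , py₁ , y₁-min
    with minimiser (enumerable-restrict enum (λ z → f z ℚ.≤? f y₁)) (py₁ , ℚ.≤-refl) g
  ... | y , (py , fy≤fy₁) , y-min =
    y , (py , λ z pz → ℚ.≤-trans fy≤fy₁ (y₁-min z pz)) ,
        ((py , ℚ.≤-refl) , λ z (pz , fz≤fy) → y-min z (pz , ℚ.≤-trans fz≤fy fy≤fy₁))

listsOfLength≤ : {A : Set} → List A → ℕ → List (List A)
listsOfLength≤ xs zero    = [ [] ]
listsOfLength≤ xs (suc N) = [] ∷ cartesianProductWith _∷_ xs (listsOfLength≤ xs N)

∈-listsOfLength≤ : {A : Set} {xs ys : List A} (N : ℕ) → ys ⊆ xs → length ys ℕ.≤ N →
                   ys ∈ listsOfLength≤ xs N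
∈-listsOfLength≤ {ys = []}     zero    _     _            = here refl
∈-listsOfLength≤ {ys = []}     (suc N) _     _            = here refl
∈-listsOfLength≤ {ys = y ∷ ys} (suc N) ys⊆xs (s≤s len≤N) =
  there (∈-cartesianProductWith⁺ _∷_ (ys⊆xs (here refl))
                                     (∈-listsOfLength≤ N (λ y∈ → ys⊆xs (there y∈)) len≤N))

Unique⇒lookup-distinct : ∀ {n} (xs : List (Fin n)) → Unique xs → ∀ i j →
                          i Fin.< j → lookup xs i ≢ lookup xs j
Unique⇒lookup-distinct (x ∷ xs) (x∉xs ∷ _) Fin.zero (Fin.suc j) _ =
  All.lookup x∉xs (∈-lookup j)
Unique⇒lookup-distinct (x ∷ xs) (_ ∷ u) (Fin.suc i) (Fin.suc j) (s≤s i<j) =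
  Unique⇒lookup-distinct xs u i j i<j

Unique⇒length≤ : ∀ {n} (xs : List (Fin n)) → Unique xs → length xs ℕ.≤ n
Unique⇒length≤ {n} xs u with length xs ℕ.≤? n
... | yes len≤n = len≤n
... | no len≰n =
  let i , j , i<j , eq = Fin.pigeonhole (ℕ.≰⇒> len≰n) (lookup xs)
  in ⊥-elim (Unique⇒lookup-distinct xs u i j i<j eq)

Σᵛ : ∀ {k} → Vec ℚ k → ℚ
Σᵛ []       = 0ℚ
Σᵛ (a ∷ as) = a + Σᵛ as

Σᵛ-mono-≤ : ∀ {k} {a b : Vec ℚ k} → a ≤ᵛ b → Σᵛ a ≤ Σᵛ b
Σᵛ-mono-≤ []         = ℚ.≤-refl
Σᵛ-mono-≤ (x≤y ∷ le) = ℚ.+-mono-≤ x≤y (Σᵛ-mono-≤ le)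

≤∧≢⇒< : ∀ {x y : ℚ} → x ≤ y → x ≢ y → x < y
≤∧≢⇒< {x} {y} x≤y x≢y with x ℚ.<? y
... | yes x<y = x<y
... | no x≮y  = ⊥-elim (x≢y (ℚ.≤-antisym x≤y (ℚ.≮⇒≥ x≮y)))

Σᵛ-mono-<ᴾ : ∀ {k} {a b : Vec ℚ k} → a <ᴾ b → Σᵛ a < Σᵛ b
Σᵛ-mono-<ᴾ ([] , a≢b) = ⊥-elim (a≢b refl)
Σᵛ-mono-<ᴾ {a = x ∷ as} {y ∷ bs} (x≤y ∷ le , a≢b) with x ℚ.≟ y
... | yes refl = ℚ.+-mono-≤-< (ℚ.≤-refl {x})
                             (Σᵛ-mono-<ᴾ (le , λ as≡bs → a≢b (cong (x ∷_) as≡bs)))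
... | no x≢y   = ℚ.+-mono-<-≤ (≤∧≢⇒< x≤y x≢y) (Σᵛ-mono-≤ le)

module _ {d k 𝒯 p} (dim : ParetoDimension d k 𝒯 p)
         {m} (τ : Fin m → Fun) (τ∈𝒯 : ∀ e → 𝒯 (τ e)) where
  open ParetoDimension dim

  -- sumFun τ ends in 0ᶠ, which need not lie in 𝒯, and p need not respect pointwise equality
  -- of functions; so a nonempty sum is rebuilt without that final summand.
  sum⁺ : Fin m → List (Fin m) → Fun
  sum⁺ e []         = τ e
  sum⁺ e (e₁ ∷ es) = τ e +ᶠ sum⁺ e₁ es

  sum⁺∈𝒯 : ∀ e es → 𝒯 (sum⁺ e es)
  sum⁺∈𝒯 e []         = τ∈𝒯 e
  sum⁺∈𝒯 e (e₁ ∷ es) = closed+ _ _ (τ∈𝒯 e) (sum⁺∈𝒯 e₁ es)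

  pathWeight≡p[sum⁺] : ∀ e es → pathWeight (λ e → p (τ e)) (e ∷ es) ≡ p (sum⁺ e es)
  pathWeight≡p[sum⁺] e []         = Vec.zipWith-identityʳ ℚ.+-identityʳ (p (τ e))
  pathWeight≡p[sum⁺] e (e₁ ∷ es) = trans (cong (p (τ e) +ᵛ_) (pathWeight≡p[sum⁺] e₁ es))
                                         (sym (additive _ _ (τ∈𝒯 e) (sum⁺∈𝒯 e₁ es)))

  sumFun≗sum⁺ : ∀ e es x → sumFun τ (e ∷ es) x ≡ sum⁺ e es x
  sumFun≗sum⁺ e []         x = ℚ.+-identityʳ (τ e x)
  sumFun≗sum⁺ e (e₁ ∷ es) x = cong (τ e x +_) (sumFun≗sum⁺ e₁ es x)

  pathWeight-≤⇒sumFun-≤ : ∀ e es e′ es′ →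
    pathWeight (λ e → p (τ e)) (e ∷ es) ≤ᵛ pathWeight (λ e → p (τ e)) (e′ ∷ es′) →
    sumFun τ (e ∷ es) ≤[ d ] sumFun τ (e′ ∷ es′)
  pathWeight-≤⇒sumFun-≤ e es e′ es′ w≤w′ x x∈[0,d] =
    subst₂ _≤_ (sym (sumFun≗sum⁺ e es x)) (sym (sumFun≗sum⁺ e′ es′ x)) (sum⁺≤sum⁺′ x x∈[0,d])
    where
    sum⁺≤sum⁺′ : sum⁺ e es ≤[ d ] sum⁺ e′ es′
    sum⁺≤sum⁺′ = Equivalence.from (order-iff _ _ (sum⁺∈𝒯 e es) (sum⁺∈𝒯 e′ es′))
      (subst₂ _≤ᵛ_ (pathWeight≡p[sum⁺] e es) (pathWeight≡p[sum⁺] e′ es′) w≤w′)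

module _ (G : Graph) where
  open Graph G

  walk-target∈heads : ∀ {u v} e es → IsWalk G u v (e ∷ es) → v ∈ map head (e ∷ es)
  walk-target∈heads e []         (_ , refl) = here refl
  walk-target∈heads e (e₁ ∷ es) (_ , walk)  = there (walk-target∈heads e₁ es walk)

  simplePath-closed⇒[] : ∀ {u} P → IsSimplePath G u u P → P ≡ []
  simplePath-closed⇒[] []       _                      = refl
  simplePath-closed⇒[] (e ∷ es) (walk , u∉heads ∷ _) =
    ⊥-elim (All.lookup u∉heads (walk-target∈heads e es walk) refl)

  simplePath-[]-unique : ∀ {u v} P → IsSimplePath G u v [] → IsSimplePath G u v P → P ≡ []
  simplePath-[]-unique P (refl , _) = simplePath-closed⇒[] P

  simplePath-length< : ∀ {u v} P → IsSimplePath G u v P → length P ℕ.< n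
  simplePath-length< {u} P (_ , unique) =
    subst (ℕ._≤ n) (cong suc (List.length-map head P))
          (Unique⇒length≤ (walkVertices G u P) unique)

  isWalk? : ∀ u v es → Dec (IsWalk G u v es)
  isWalk? u v []       = u ≟ᶠ v
  isWalk? u v (e ∷ es) = (tail e ≟ᶠ u) ×-dec isWalk? (head e) v es

module _ {m : ℕ} where
  open import Data.List.Membership.DecPropositional (_≟ᶠ_ {m}) using (_∈?_)

  edgeDisjoint? : ∀ A B → Dec (EdgeDisjoint A B)
  edgeDisjoint? A B = map′ (λ A∉B e → All.lookup A∉B) (λ disj → All.tabulate (disj _))
                           (All.all? (λ e → ¬? (e ∈? B)) A)

  edgeDisjoint⇒∩≡[] : ∀ A B → EdgeDisjoint A B → A ∩ B ≡ []
  edgeDisjoint⇒∩≡[] A B disj = List.filter-none (_∈? B) (All.tabulate (disj _))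

module _ (G : Graph) (d : ℚ) (c : CostFunctions G d) (s t : Fin (Graph.n G))
         (Q : List (Fin (Graph.m G))) where
  open Graph G
  open CostFunctions c
  open Setting G d c s t Q
  open import Data.List.Relation.Unary.Unique.DecPropositional (_≟ᶠ_ {n}) using (unique?)

  dFeasible? : Decidable DFeasible
  dFeasible? P = (isWalk? G s t P ×-dec unique? (walkVertices G s P)) ×-dec edgeDisjoint? P Q

  dFeasible-enumerable : Enumerable DFeasible
  dFeasible-enumerable = enumerable-cover (listsOfLength≤ (allFin m) n)
    (λ P (path , _) → ∈-listsOfLength≤ n (λ {e} _ → ∈-allFin e)
                                         (ℕ.<⇒≤ (simplePath-length< G P path)))
    dFeasible?

  module _ {k 𝒯 p} (dim : ParetoDimension d k 𝒯 p) (τ∈𝒯 : ∀ e → 𝒯 (τ e))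
           (M : PsychModel) (conform : WeaklyParetoConform M) where
    open PsychModel M

    w : Fin m → Vec ℚ k
    w e = p (τ e)

    weightDominance⇒𝒞≤ : ∀ P′ P → DFeasible P′ → DFeasible P →
                          pathWeight w P′ <ᴾ pathWeight w P → 𝒞[ P′ ] ≤ 𝒞[ P ]
    weightDominance⇒𝒞≤ [] P (path′ , _) (path , _) (_ , w≢w) =
      ⊥-elim (w≢w (cong (pathWeight w) (sym (simplePath-[]-unique G P path′ path))))
    weightDominance⇒𝒞≤ P′@(_ ∷ _) [] (path′ , _) (path , _) (_ , w≢w) =
      ⊥-elim (w≢w (cong (pathWeight w) (simplePath-[]-unique G P′ path path′)))
    weightDominance⇒𝒞≤ P′@(e′ ∷ es′) P@(e ∷ es) (path′ , disj′) (path , disj) (w≤w , _) =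
      conform P′ P path′ path
        (subst (SameEdgeSet (P′ ∩ Q)) same∩Q (λ _ → ⇔-id _))
        ( pathWeight-≤⇒sumFun-≤ dim τ τ∈𝒯 e′ es′ e es w≤w
        , subst (λ B → τ'[ P′ ∩ Q ] ≤[ d ] τ'[ B ]) same∩Q (λ x _ → ℚ.≤-refl {τ'[ P′ ∩ Q ] x}))
      where
      same∩Q : P′ ∩ Q ≡ P ∩ Q
      same∩Q = trans (edgeDisjoint⇒∩≡[] P′ Q disj′) (sym (edgeDisjoint⇒∩≡[] P Q disj))

    leastWeightSum⇒paretoOptimal : ∀ P →
      Minimises (λ P′ → DFeasible P′ × 𝒞[ P′ ] ≤ 𝒞[ P ]) (λ P′ → Σᵛ (pathWeight w P′)) P →
      ParetoOptimal w P
    leastWeightSum⇒paretoOptimal P ((feasible , _) , leastΣ) = feasible , λ P′ feasible′ w′<w →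
      ℚ.<-irrefl {Σᵛ (pathWeight w P′)} refl
        (ℚ.<-≤-trans {Σᵛ (pathWeight w P′)} {Σᵛ (pathWeight w P)} (Σᵛ-mono-<ᴾ w′<w)
          (leastΣ P′ (feasible′ , weightDominance⇒𝒞≤ P′ P feasible′ feasible w′<w)))

theorem6 : (G : Graph) (d : ℚ) → 0ℚ < d →
    (c : CostFunctions G d) → (s t : Fin (Graph.n G)) → (Q : List (Fin (Graph.m G))) →
    IsSimplePath G s t Q →
    Setting.NoMutualDominance G d c s t Q →
    (k : ℕ) (𝒯 : Fun → Set) (p : Fun → Vec ℚ k) →
    ParetoDimension d k 𝒯 p →
    (∀ e → 𝒯 (CostFunctions.τ c e)) →
    (M : Setting.PsychModel G d c s t Q) →
    Setting.WeaklyParetoConform G d c s t Q M →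
    ∃ (Setting.DFeasible G d c s t Q) →
    ∃ λ P → Setting.ParetoOptimal G d c s t Q (λ e → p (CostFunctions.τ c e)) P
    × Setting.OptimalDSAP G d c s t Q M P
theorem6 G d _ c s t Q _ _ k 𝒯 p dim τ∈𝒯 M conform (_ , feasible₀) =
  let P , optimum , leastWeightSum =
        lexMinimiser (dFeasible-enumerable G d c s t Q) feasible₀ 𝒞[_] weightSum
  in P , leastWeightSum⇒paretoOptimal G d c s t Q dim τ∈𝒯 M conform P leastWeightSum , optimum
  where
  open Setting.PsychModel M using (𝒞[_])
  weightSum : List (Fin (Graph.m G)) → ℚ
  weightSum P = Σᵛ (pathWeight (λ e → p (CostFunctions.τ c e)) P)
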